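{- For all $n\geq 1$ and all formulas $\varphi,\chi_1,\dots,\chi_n\in\mathcal{L}(\nabla,\bullet)$, $$\vdash_{\mathbf{K}^{\nabla\bullet}}\Delta\Big(\bigwedge_{k=1}^n\chi_k\to\varphi\Big)\land\bigwedge_{k=1}^n\circ(\neg\varphi\to\chi_k)\land\varphi\to\Delta\varphi.$$
   Context: Fix a nonempty set $\mathbf{P}$ of propositional variables. $\mathcal{L}(\nabla,\bullet)$: $\varphi::=p\mid\neg\varphi\mid\varphi\land\varphi\mid\nabla\varphi\mid\bullet\varphi$ ($p\in\mathbf{P}$), with $\Delta\varphi:=\neg\nabla\varphi$, $\circ\varphi:=\neg\bullet\varphi$. The system $\mathbf{K}^{\nabla\bullet}$ has axioms: A0 all propositional tautologies; A1 $\bullet\varphi\to\varphi$; A2 $\nabla\varphi\leftrightarrow\nabla\neg\varphi$; A3 $\bullet(\psi\to\varphi)\land\varphi\to\bullet\varphi$; A4 $\nabla(\varphi\land\psi)\to\nabla\varphi\vee\nabla\psi$; A5 $\bullet(\varphi\land\psi)\to\bullet\varphi\vee\bullet\psi$; A6 $\nabla\varphi\to\bullet\varphi\vee\bullet\neg\varphi$; A7 $\bullet(\varphi\to\psi)\land\bullet(\neg\varphi\to\chi)\to\nabla\varphi$; rules: from $\varphi$ infer $\Delta\varphi$; from $\varphi$ infer $\circ\varphi$; from $\varphi\leftrightarrow\psi$ infer $\Delta\varphi\leftrightarrow\Delta\psi$; from $\varphi\leftrightarrow\psi$ infer $\circ\varphi\leftrightarrow\circ\psi$; modus ponens. -}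

module Defs where

open import Data.Nat using (ℕ; suc)
open import Data.Vec using (Vec; []; _∷_)
open import Data.Bool using (Bool; true; false; not; _∧_)
open import Relation.Binary.PropositionalEquality using (_≡_)

data Form (P : Set) : Set where
  var  : P → Form P
  ¬'_  : Form P → Form P
  _∧'_ : Form P → Form P → Form P
  ∇_   : Form P → Form P
  •_   : Form P → Form P

infix 9 ¬'_ ∇_ •_
infixr 6 _∧'_

module _ {P : Set} where
  infix 9 Δ_ ∘_
  infixr 5 _∨'_
  infixr 4 _⇒_ _⇔_

  _∨'_ : Form P → Form P → Form P
  φ ∨' ψ = ¬' ((¬' φ) ∧' (¬' ψ))

  _⇒_ : Form P → Form P → Form P
  φ ⇒ ψ = ¬' (φ ∧' (¬' ψ))

  _⇔_ : Form P → Form P → Form P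
  φ ⇔ ψ = (φ ⇒ ψ) ∧' (ψ ⇒ φ)

  Δ_ : Form P → Form P
  Δ φ = ¬' (∇ φ)

  ∘_ : Form P → Form P
  ∘ φ = ¬' (• φ)

  -- Propositional tautologies: formulas true under every Boolean valuation
  -- in which the atoms are the propositional variables and the maximal
  -- modal subformulas ∇ψ, •ψ (assigned arbitrary truth values).
  eval : (P → Bool) → (Form P → Bool) → (Form P → Bool) → Form P → Bool
  eval v n b (var p)  = v p
  eval v n b (¬' φ)   = not (eval v n b φ)
  eval v n b (φ ∧' ψ) = eval v n b φ ∧ eval v n b ψ
  eval v n b (∇ φ)    = n φ
  eval v n b (• φ)    = b φ

  Tautology : Form P → Set
  Tautology φ = ∀ v n b → eval v n b φ ≡ true

  data ⊢_ : Form P → Set where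
    A0 : ∀ {φ} → Tautology φ → ⊢ φ
    A1 : ∀ {φ} → ⊢ (• φ ⇒ φ)
    A2 : ∀ {φ} → ⊢ (∇ φ ⇔ ∇ (¬' φ))
    A3 : ∀ {φ ψ} → ⊢ ((• (ψ ⇒ φ) ∧' φ) ⇒ • φ)
    A4 : ∀ {φ ψ} → ⊢ (∇ (φ ∧' ψ) ⇒ (∇ φ ∨' ∇ ψ))
    A5 : ∀ {φ ψ} → ⊢ (• (φ ∧' ψ) ⇒ (• φ ∨' • ψ))
    A6 : ∀ {φ} → ⊢ (∇ φ ⇒ (• φ ∨' • (¬' φ)))
    A7 : ∀ {φ ψ χ} → ⊢ ((• (φ ⇒ ψ) ∧' • ((¬' φ) ⇒ χ)) ⇒ ∇ φ)
    NecΔ : ∀ {φ} → ⊢ φ → ⊢ (Δ φ)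
    Nec∘ : ∀ {φ} → ⊢ φ → ⊢ (∘ φ)
    REΔ : ∀ {φ ψ} → ⊢ (φ ⇔ ψ) → ⊢ (Δ φ ⇔ Δ ψ)
    RE∘ : ∀ {φ ψ} → ⊢ (φ ⇔ ψ) → ⊢ (∘ φ ⇔ ∘ ψ)
    MP  : ∀ {φ ψ} → ⊢ (φ ⇒ ψ) → ⊢ φ → ⊢ ψ

  ⋀ : ∀ {n} → Vec (Form P) (suc n) → Form P
  ⋀ (χ ∷ [])     = χ
  ⋀ (χ ∷ ψ ∷ χs) = χ ∧' ⋀ (ψ ∷ χs)

  ⋀∘ : ∀ {n} → Form P → Vec (Form P) (suc n) → Form P
  ⋀∘ φ (χ ∷ [])     = ∘ ((¬' φ) ⇒ χ)
  ⋀∘ φ (χ ∷ ψ ∷ χs) = ∘ ((¬' φ) ⇒ χ) ∧' ⋀∘ φ (ψ ∷ χs)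

-- Write C for ⋀ χ. The hypotheses ∘(¬φ → χₖ) combine (A5) into ∘(¬φ → C); since φ
-- holds, so does ¬φ → C, and an essential truth is noncontingent (A1, A6), giving
-- Δ(¬φ → C), i.e. Δ(¬C → φ). Together with Δ(C → φ), axiom A4 yields
-- Δ((C → φ) ∧ (¬C → φ)), and the conjunction is equivalent to φ.
module Submission where

open import Defs
open import Data.Bool using (Bool; true; false; not; _∧_; T)
open import Data.Bool.Properties using (T-≡; T-∧)
open import Data.Fin using (Fin; zero; suc)
open import Data.Nat using (ℕ; suc)
open import Data.Product using (proj₁; proj₂)
open import Data.Vec using (Vec; []; _∷_; lookup; map)
open import Data.Vec.Properties using (lookup-map)
open import Function using (Equivalence; const)
import Relation.Binary.Reasoning.Base.Single as SingleRelationReasoning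
open import Relation.Binary.PropositionalEquality using (_≡_; refl; sym; trans; cong; cong₂)

open Equivalence using (to)

_[_] : ∀ {P k} → Form (Fin k) → Vec (Form P) k → Form P
var i    [ ρ ] = lookup ρ i
(¬' φ)   [ ρ ] = ¬' (φ [ ρ ])
(φ ∧' ψ) [ ρ ] = φ [ ρ ] ∧' ψ [ ρ ]
(∇ φ)    [ ρ ] = ∇ (φ [ ρ ])
(• φ)    [ ρ ] = • (φ [ ρ ])

isPropositional : ∀ {P} → Form P → Bool
isPropositional (var _)  = true
isPropositional (¬' φ)   = isPropositional φ
isPropositional (φ ∧' ψ) = isPropositional φ ∧ isPropositional ψ
isPropositional (∇ _)    = false
isPropositional (• _)    = false

allAssignments : (k : ℕ) → (Vec Bool k → Bool) → Bool
allAssignments ℕ.zero    p = p []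
allAssignments (suc k) p = allAssignments k (λ σ → p (true ∷ σ)) ∧ allAssignments k (λ σ → p (false ∷ σ))

allAssignments-sound : ∀ k {p} → T (allAssignments k p) → ∀ σ → T (p σ)
allAssignments-sound ℕ.zero    holds []          = holds
allAssignments-sound (suc k) holds (true ∷ σ)  = allAssignments-sound k (proj₁ (to T-∧ holds)) σ
allAssignments-sound (suc k) holds (false ∷ σ) = allAssignments-sound k (proj₂ (to T-∧ holds)) σ

-- Modal subformulas must be excluded: ∇ and • are evaluated by arbitrary functions
-- of the formula, not of the truth values of its atoms, so they do not commute
-- with substitution.
isTautologyᵇ : ∀ {k} → Form (Fin k) → Bool
isTautologyᵇ {k} φ = isPropositional φ ∧ allAssignments k (λ σ → eval (lookup σ) (const false) (const false) φ)

module _ {P : Set} where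

  eval-[] : ∀ {k} v n b (φ : Form (Fin k)) (ρ : Vec (Form P) k) → T (isPropositional φ) →
            eval v n b (φ [ ρ ]) ≡ eval (lookup (map (eval v n b) ρ)) (const false) (const false) φ
  eval-[] v n b (var i)  ρ prop = sym (lookup-map i (eval v n b) ρ)
  eval-[] v n b (¬' φ)   ρ prop = cong not (eval-[] v n b φ ρ prop)
  eval-[] v n b (φ ∧' ψ) ρ prop =
    cong₂ _∧_ (eval-[] v n b φ ρ (proj₁ (to T-∧ prop))) (eval-[] v n b ψ ρ (proj₂ (to T-∧ prop)))

  tautology : ∀ {k} (φ : Form (Fin k)) {valid : T (isTautologyᵇ φ)} (ρ : Vec (Form P) k) → ⊢ (φ [ ρ ])
  tautology {k} φ {valid} ρ = A0 λ v n b →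
    trans (eval-[] v n b φ ρ (proj₁ (to T-∧ valid)))
          (to T-≡ (allAssignments-sound k (proj₂ (to T-∧ valid)) (map (eval v n b) ρ)))

α : ∀ {k} → Form (Fin (suc k))
α = var zero

β : ∀ {k} → Form (Fin (suc (suc k)))
β = var (suc zero)

γ : ∀ {k} → Form (Fin (suc (suc (suc k))))
γ = var (suc (suc zero))

δ : ∀ {k} → Form (Fin (suc (suc (suc (suc k)))))
δ = var (suc (suc (suc zero)))

module _ {P : Set} where

  private variable a b c : Form P

  ⇒-refl : ⊢ (a ⇒ a)
  ⇒-refl {a} = tautology (α ⇒ α) (a ∷ [])

  ⇒-trans : ⊢ (a ⇒ b) → ⊢ (b ⇒ c) → ⊢ (a ⇒ c)
  ⇒-trans {a} {b} {c} a⇒b b⇒c =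
    MP (MP (tautology ((α ⇒ β) ⇒ (β ⇒ γ) ⇒ (α ⇒ γ)) (a ∷ b ∷ c ∷ [])) a⇒b) b⇒c

  ∧-monoˡ : ⊢ (a ⇒ b) → ⊢ (a ∧' c ⇒ b ∧' c)
  ∧-monoˡ {a} {b} {c} = MP (tautology ((α ⇒ β) ⇒ (α ∧' γ ⇒ β ∧' γ)) (a ∷ b ∷ c ∷ []))

  ∧-monoʳ : ⊢ (a ⇒ b) → ⊢ (c ∧' a ⇒ c ∧' b)
  ∧-monoʳ {a} {b} {c} = MP (tautology ((α ⇒ β) ⇒ (γ ∧' α ⇒ γ ∧' β)) (a ∷ b ∷ c ∷ []))

  ⇔⇒⇒ : ⊢ (a ⇔ b) → ⊢ (a ⇒ b)
  ⇔⇒⇒ {a} {b} = MP (tautology ((α ⇔ β) ⇒ (α ⇒ β)) (a ∷ b ∷ []))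

  Δ-cong : ⊢ (a ⇔ b) → ⊢ (Δ a ⇒ Δ b)
  Δ-cong a⇔b = ⇔⇒⇒ (REΔ a⇔b)

  ∘-cong : ⊢ (a ⇔ b) → ⊢ (∘ a ⇒ ∘ b)
  ∘-cong a⇔b = ⇔⇒⇒ (RE∘ a⇔b)

module ⊢⇒-Reasoning {P : Set} =
  SingleRelationReasoning (λ (a b : Form P) → ⊢ (a ⇒ b)) ⇒-refl ⇒-trans

module _ {P : Set} where

  open ⊢⇒-Reasoning

  private variable a b c : Form P

  ∘∧∘⇒∘∧ : ⊢ (∘ a ∧' ∘ b ⇒ ∘ (a ∧' b))
  ∘∧∘⇒∘∧ {a} {b} =
    MP (tautology ((α ⇒ β ∨' γ) ⇒ (¬' β ∧' ¬' γ ⇒ ¬' α)) (• (a ∧' b) ∷ • a ∷ • b ∷ [])) A5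

  Δ∧Δ⇒Δ∧ : ⊢ (Δ a ∧' Δ b ⇒ Δ (a ∧' b))
  Δ∧Δ⇒Δ∧ {a} {b} =
    MP (tautology ((α ⇒ β ∨' γ) ⇒ (¬' β ∧' ¬' γ ⇒ ¬' α)) (∇ (a ∧' b) ∷ ∇ a ∷ ∇ b ∷ [])) A4

  -- By A6, ∇a gives •a, excluded by ∘a, or •¬a, which contradicts a by A1.
  ∘∧⇒Δ : ⊢ (∘ a ∧' a ⇒ Δ a)
  ∘∧⇒Δ {a} = MP (MP (tautology ((α ⇒ β ∨' γ) ⇒ (γ ⇒ ¬' δ) ⇒ (¬' β ∧' δ ⇒ ¬' α))
                               (∇ a ∷ • a ∷ • ¬' a ∷ a ∷ [])) A6) A1

  ⋀∘⇒∘⋀ : ∀ {n} φ (χ : Vec (Form P) (suc n)) → ⊢ (⋀∘ φ χ ⇒ ∘ (¬' φ ⇒ ⋀ χ))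
  ⋀∘⇒∘⋀ φ (χ ∷ [])     = ⇒-refl
  ⋀∘⇒∘⋀ φ (χ ∷ ψ ∷ χs) = begin
    ∘ (¬' φ ⇒ χ) ∧' ⋀∘ φ (ψ ∷ χs)                 ∼⟨ ∧-monoʳ (⋀∘⇒∘⋀ φ (ψ ∷ χs)) ⟩
    ∘ (¬' φ ⇒ χ) ∧' ∘ (¬' φ ⇒ ⋀ (ψ ∷ χs))         ∼⟨ ∘∧∘⇒∘∧ ⟩
    ∘ ((¬' φ ⇒ χ) ∧' (¬' φ ⇒ ⋀ (ψ ∷ χs)))         ∼⟨ ∘-cong ⇒-distrib-∧ ⟩
    ∘ (¬' φ ⇒ χ ∧' ⋀ (ψ ∷ χs))                    ∎
    where
    ⇒-distrib-∧ : ⊢ ((¬' φ ⇒ χ) ∧' (¬' φ ⇒ ⋀ (ψ ∷ χs)) ⇔ (¬' φ ⇒ χ ∧' ⋀ (ψ ∷ χs)))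
    ⇒-distrib-∧ = tautology ((¬' α ⇒ β) ∧' (¬' α ⇒ γ) ⇔ (¬' α ⇒ β ∧' γ)) (φ ∷ χ ∷ ⋀ (ψ ∷ χs) ∷ [])

  ∘∧⇒Δ-contrapositive : ⊢ (∘ (¬' a ⇒ c) ∧' a ⇒ Δ (¬' c ⇒ a))
  ∘∧⇒Δ-contrapositive {a} {c} = begin
    ∘ (¬' a ⇒ c) ∧' a           ∼⟨ ∧-monoʳ (tautology (α ⇒ (¬' α ⇒ β)) (a ∷ c ∷ [])) ⟩
    ∘ (¬' a ⇒ c) ∧' (¬' a ⇒ c)  ∼⟨ ∘∧⇒Δ ⟩
    Δ (¬' a ⇒ c)                ∼⟨ Δ-cong (tautology ((¬' α ⇒ β) ⇔ (¬' β ⇒ α)) (a ∷ c ∷ [])) ⟩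
    Δ (¬' c ⇒ a)                ∎

  Δ-by-cases : ⊢ (Δ (c ⇒ a) ∧' Δ (¬' c ⇒ a) ⇒ Δ a)
  Δ-by-cases {c} {a} = begin
    Δ (c ⇒ a) ∧' Δ (¬' c ⇒ a)   ∼⟨ Δ∧Δ⇒Δ∧ ⟩
    Δ ((c ⇒ a) ∧' (¬' c ⇒ a))   ∼⟨ Δ-cong (tautology ((β ⇒ α) ∧' (¬' β ⇒ α) ⇔ α) (a ∷ c ∷ [])) ⟩
    Δ a                          ∎

mainTheorem20 : {P : Set} → P → (n : ℕ) → (φ : Form P) → (χ : Vec (Form P) (suc n)) →
    ⊢ ((Δ (⋀ χ ⇒ φ) ∧' ⋀∘ φ χ ∧' φ) ⇒ Δ φ)
mainTheorem20 _ _ φ χ = begin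
  Δ (⋀ χ ⇒ φ) ∧' ⋀∘ φ χ ∧' φ            ∼⟨ ∧-monoʳ (∧-monoˡ (⋀∘⇒∘⋀ φ χ)) ⟩
  Δ (⋀ χ ⇒ φ) ∧' ∘ (¬' φ ⇒ ⋀ χ) ∧' φ    ∼⟨ ∧-monoʳ ∘∧⇒Δ-contrapositive ⟩
  Δ (⋀ χ ⇒ φ) ∧' Δ (¬' ⋀ χ ⇒ φ)        ∼⟨ Δ-by-cases ⟩
  Δ φ                                   ∎
  where open ⊢⇒-Reasoning
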